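{- Let $T$ be a stably-infinite $\Sigma$-theory, let $\Gamma$ be a conjunction of $\Sigma$-literals, and let $M$ be a conjunction of possibly negated membership constraints. Then $\Gamma\cup M$ is $T$-satisfiable if and only if there exists an equivalence relation $E$ on the set $V$ of variables shared by $\Gamma$ and $M$ such that $\Gamma\cup\alpha(V,E)$ is $T$-satisfiable and $M\cup\alpha(V,E)$ is satisfiable.
   Context: Setting: first-order logic with equality. A $\Sigma$-theory $T$ is stably-infinite if for every $T$-satisfiable quantifier-free $\Sigma$-formula $F$ there is an interpretation satisfying $F\wedge T$ whose domain is infinite. For an equivalence relation $E$ on a set of variables $V$, the arrangement of $V$ induced by $E$ is $\alpha(V,E)=\{x=y \mid x\,E\,y\}\cup\{x\neq y \mid x,y\in V \text{ and not } x\,E\,y\}$. A membership constraint is a constraint of the form $(x_1,\dots,x_k)\in\{(y_{1,1},\dots,y_{1,k}),\dots,(y_{l,1},\dots,y_{l,k})\}$ for positive integers $k,l$ and variable symbols $x_i$, $y_{j,i}$; it means $\bigvee_{j=1}^{l}\bigwedge_{i=1}^{k} x_i=y_{j,i}$ (a formula over the empty signature, i.e. pure equality). -}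

module Defs where

open import Level using (0ℓ) renaming (suc to lsuc)
open import Data.Nat using (ℕ; suc; _≟_)
open import Data.Empty using (⊥)
open import Data.Product using (Σ; ∃; _×_; _,_; proj₁)
open import Data.Sum using (_⊎_)
open import Data.List using (List; []; _∷_; _++_; filter; concatMap)
open import Data.List.Membership.Propositional using (_∈_)
open import Data.List.Relation.Unary.Any using (Any)
open import Data.Vec using (Vec; foldr₁; zipWith; toList) renaming (map to vmap; [] to v[]; _∷_ to _v∷_)
open import Function.Bundles using (_↔_)
open import Data.Fin using (Fin)
open import Relation.Nullary using (¬_; ¬?)
open import Relation.Binary using (Rel)
open import Relation.Binary.PropositionalEquality using (_≡_)

record Signature : Set₁ where
  field
    Fun       : Set
    funArity  : Fun → ℕ
    Pred      : Set
    predArity : Pred → ℕ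
open Signature public

emptySig : Signature
emptySig = record { Fun = ⊥ ; funArity = λ () ; Pred = ⊥ ; predArity = λ () }

data Term (S : Signature) : Set where
  var : ℕ → Term S
  app : (f : Fun S) → Vec (Term S) (funArity S f) → Term S

data Formula (S : Signature) : Set where
  eq   : Term S → Term S → Formula S
  rel  : (p : Pred S) → Vec (Term S) (predArity S p) → Formula S
  ¬'_  : Formula S → Formula S
  _∧'_ : Formula S → Formula S → Formula S
  _∨'_ : Formula S → Formula S → Formula S
  _⇒'_ : Formula S → Formula S → Formula S
  all' : ℕ → Formula S → Formula S
  ex'  : ℕ → Formula S → Formula S

data QF {S : Signature} : Formula S → Set where
  qf-eq  : ∀ {t u} → QF (eq t u)
  qf-rel : ∀ {p ts} → QF (rel p ts)
  qf-¬   : ∀ {φ} → QF φ → QF (¬' φ)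
  qf-∧   : ∀ {φ ψ} → QF φ → QF ψ → QF (φ ∧' ψ)
  qf-∨   : ∀ {φ ψ} → QF φ → QF ψ → QF (φ ∨' ψ)
  qf-⇒   : ∀ {φ ψ} → QF φ → QF ψ → QF (φ ⇒' ψ)

mutual
  varsT : {S : Signature} → Term S → List ℕ
  varsT (var x)    = x ∷ []
  varsT (app f ts) = varsTs ts

  varsTs : {S : Signature} {n : ℕ} → Vec (Term S) n → List ℕ
  varsTs v[]       = []
  varsTs (t v∷ ts) = varsT t ++ varsTs ts

fv : {S : Signature} → Formula S → List ℕ
fv (eq t u)   = varsT t ++ varsT u
fv (rel p ts) = varsTs ts
fv (¬' φ)     = fv φ
fv (φ ∧' ψ)   = fv φ ++ fv ψ
fv (φ ∨' ψ)   = fv φ ++ fv ψ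
fv (φ ⇒' ψ)   = fv φ ++ fv ψ
fv (all' x φ) = filter (λ y → ¬? (y ≟ x)) (fv φ)
fv (ex' x φ)  = filter (λ y → ¬? (y ≟ x)) (fv φ)

Sentence : {S : Signature} → Formula S → Set
Sentence φ = fv φ ≡ []

record Structure (S : Signature) : Set₁ where
  field
    Dom   : Set
    funI  : (f : Fun S) → Vec Dom (funArity S f) → Dom
    predI : (p : Pred S) → Vec Dom (predArity S p) → Set
open Structure public

module _ {S : Signature} (A : Structure S) where
  mutual
    evalT : (ℕ → Dom A) → Term S → Dom A
    evalT v (var x)    = v x
    evalT v (app f ts) = funI A f (evalTs v ts)

    evalTs : {n : ℕ} → (ℕ → Dom A) → Vec (Term S) n → Vec (Dom A) n
    evalTs v v[]       = v[]
    evalTs v (t v∷ ts) = evalT v t v∷ evalTs v ts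

  update : (ℕ → Dom A) → ℕ → Dom A → ℕ → Dom A
  update v x d y with y ≟ x
  ... | Relation.Nullary.yes _ = d
  ... | Relation.Nullary.no  _ = v y

  sat : (ℕ → Dom A) → Formula S → Set
  sat v (eq t u)   = evalT v t ≡ evalT v u
  sat v (rel p ts) = predI A p (evalTs v ts)
  sat v (¬' φ)     = ¬ sat v φ
  sat v (φ ∧' ψ)   = sat v φ × sat v ψ
  sat v (φ ∨' ψ)   = sat v φ ⊎ sat v ψ
  sat v (φ ⇒' ψ)   = sat v φ → sat v ψ
  sat v (all' x φ) = (d : Dom A) → sat (update v x d) φ
  sat v (ex' x φ)  = Σ (Dom A) λ d → sat (update v x d) φ

FSet : Signature → Set₁
FSet S = Formula S → Set

_∪_ : {S : Signature} → FSet S → FSet S → FSet S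
(Φ ∪ Ψ) φ = Φ φ ⊎ Ψ φ

SatSet : {S : Signature} (A : Structure S) → (ℕ → Dom A) → FSet S → Set
SatSet A v Φ = ∀ φ → Φ φ → sat A v φ

Theory : Signature → Set₁
Theory S = FSet S

IsTheory : {S : Signature} → Theory S → Set
IsTheory T = ∀ φ → T φ → Sentence φ

Satisfiable : {S : Signature} → FSet S → Set₁
Satisfiable {S} Φ = Σ (Structure S) λ A → Σ (ℕ → Dom A) λ v → SatSet A v Φ

TSatisfiable : {S : Signature} → Theory S → FSet S → Set₁
TSatisfiable {S} T Φ =
  Σ (Structure S) λ A → Σ (ℕ → Dom A) λ v → SatSet A v T × SatSet A v Φ

Infinite : Set → Set
Infinite D = ∀ n → ¬ (D ↔ Fin n)

StablyInfinite : {S : Signature} → Theory S → Set₁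
StablyInfinite {S} T =
  ∀ (F : Formula S) → QF F → TSatisfiable T (_≡ F) →
  Σ (Structure S) λ A → Σ (ℕ → Dom A) λ v →
    Infinite (Dom A) × SatSet A v T × sat A v F

data Atom {S : Signature} : Formula S → Set where
  atom-eq  : ∀ {t u} → Atom (eq t u)
  atom-rel : ∀ {p ts} → Atom (rel p ts)

data Literal (S : Signature) : Set where
  posL : (a : Formula S) → Atom a → Literal S
  negL : (a : Formula S) → Atom a → Literal S

litFormula : {S : Signature} → Literal S → Formula S
litFormula (posL a _) = a
litFormula (negL a _) = ¬' a

litVars : {S : Signature} → Literal S → List ℕ
litVars l = fv (litFormula l)

-- a conjunction of literals, viewed as the set of its conjuncts
LitSet : {S : Signature} → List (Literal S) → FSet S
LitSet Γ φ = Any (λ l → φ ≡ litFormula l) Γ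

-- membership constraint (x_1..x_k) ∈ {(y_11..y_1k), ..., (y_l1..y_lk)}
-- with k = suc k' ≥ 1 and l = suc l' ≥ 1
record MemConstraint : Set where
  constructor memb
  field
    {k' l'} : ℕ
    xs : Vec ℕ (suc k')
    ys : Vec (Vec ℕ (suc k')) (suc l')

-- its meaning: ⋁_j ⋀_i x_i = y_{j,i}  (pure equality, usable over any signature)
memFormula : {S : Signature} → MemConstraint → Formula S
memFormula (memb xs ys) =
  foldr₁ _∨'_ (vmap (λ row → foldr₁ _∧'_ (zipWith (λ x y → eq (var x) (var y)) xs row)) ys)

memVars : MemConstraint → List ℕ
memVars (memb xs ys) = toList xs ++ concatMap toList (toList ys)

data MemLit : Set where
  posM : MemConstraint → MemLit
  negM : MemConstraint → MemLit

memLitFormula : {S : Signature} → MemLit → Formula S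
memLitFormula (posM c) = memFormula c
memLitFormula (negM c) = ¬' memFormula c

memLitVars : MemLit → List ℕ
memLitVars (posM c) = memVars c
memLitVars (negM c) = memVars c

MemSet : {S : Signature} → List MemLit → FSet S
MemSet M φ = Any (λ m → φ ≡ memLitFormula m) M

Shared : {S : Signature} → List (Literal S) → List MemLit → ℕ → Set
Shared Γ M x = x ∈ concatMap litVars Γ × x ∈ concatMap memLitVars M

arrangement : {S : Signature} (V : ℕ → Set) → Rel (Σ ℕ V) 0ℓ → FSet S
arrangement V E φ =
  Σ (Σ ℕ V) λ a → Σ (Σ ℕ V) λ b →
    (E a b × φ ≡ eq (var (proj₁ a)) (var (proj₁ b)))
    ⊎ (¬ E a b × φ ≡ ¬' eq (var (proj₁ a)) (var (proj₁ b)))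

-- A model of Γ ∪ M induces an arrangement of the shared variables satisfied by both halves.
-- Conversely, stable infiniteness turns the model of T ∪ Γ into an infinite one inducing the
-- same arrangement on the variables of Γ. Membership constraints are pure equality, so their
-- truth depends only on which of their variables are equal; hence the valuation may be
-- redefined off the variables of Γ: a variable of M takes the value of a shared variable it
-- equals in the model of M, if there is one, and otherwise a fresh element of the infinite
-- domain, distinct values receiving distinct fresh elements.

module Submission where

open import Defs
open import Level using (0ℓ) renaming (suc to lsuc)
open import Axiom.ExcludedMiddle using (ExcludedMiddle)
open import Data.Nat using (ℕ; zero; suc; _≟_; _<_; s≤s)
open import Data.Nat.Properties using (<-cmp; m≤n⇒m<n∨m≡n)
open import Data.Fin using (Fin) renaming (zero to fzero; suc to fsuc)
open import Data.Empty using (⊥-elim)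
open import Data.Product using (Σ; ∃; _×_; _,_; proj₁; proj₂)
open import Data.Sum using (inj₁; inj₂; [_,_]′)
open import Data.List using (List; []; _∷_; _++_; map; concatMap; filter; deduplicate; lookup; length)
open import Data.List.Membership.Propositional using (_∈_; _∉_; find; lose)
open import Data.List.Membership.Propositional.Properties
  using (∉[]; ∈-++⁺ˡ; ∈-++⁺ʳ; ∈-map⁺; ∈-concat⁺′; ∈-concatMap⁺; ∈-filter⁺; ∈-deduplicate⁺; ∈-lookup)
open import Data.List.Membership.Propositional.Properties.WithK using (unique⇒irrelevant)
open import Data.List.Relation.Unary.Any using (here; there; index)
open import Data.List.Relation.Unary.Any.Properties using (lookup-index)
open import Data.List.Relation.Unary.All as All using (All)
open import Data.List.Relation.Unary.All.Properties using (++⁺; ++⁻; concat⁺; map⁺; map⁻)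
open import Data.List.Relation.Unary.Unique.DecPropositional.Properties using (deduplicate-!)
open import Data.Vec using (Vec; foldr₁; zipWith; toList) renaming (map to vmap; [] to v[]; _∷_ to _v∷_)
import Data.Vec.Relation.Unary.Any as Vec
open import Data.Vec.Relation.Binary.Pointwise.Inductive using (Pointwise) renaming ([] to p[]; _∷_ to _p∷_)
open import Function using (_∘_; _on_)
open import Function.Definitions using (Injective)
open import Function.Bundles using (_↔_; _⇔_; mk⇔; mk↔ₛ′; Equivalence)
import Function.Properties.Equivalence as ⇔
open import Relation.Nullary using (¬?; Dec; yes; no)
open import Relation.Nullary.Decidable using (decidable-stable)
open import Relation.Binary using (Rel; IsEquivalence; DecidableEquality; tri<; tri≈; tri>)
import Relation.Binary.Construct.On as On
open import Relation.Binary.PropositionalEquality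
  using (_≡_; _≢_; refl; sym; trans; cong; cong₂; subst; isEquivalence)

open Equivalence using (to; from)

module _ {S : Signature} (A : Structure S) where

  mutual
    evalT-cong : ∀ {v w} t → (∀ {x} → x ∈ varsT t → v x ≡ w x) → evalT A v t ≡ evalT A w t
    evalT-cong (var x)    v≗w = v≗w (here refl)
    evalT-cong (app f ts) v≗w = cong (funI A f) (evalTs-cong ts v≗w)

    evalTs-cong : ∀ {n v w} (ts : Vec (Term S) n) → (∀ {x} → x ∈ varsTs ts → v x ≡ w x) →
                  evalTs A v ts ≡ evalTs A w ts
    evalTs-cong v[]       v≗w = refl
    evalTs-cong (t v∷ ts) v≗w =
      cong₂ _v∷_ (evalT-cong t (v≗w ∘ ∈-++⁺ˡ)) (evalTs-cong ts (v≗w ∘ ∈-++⁺ʳ (varsT t)))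

  update-cong : ∀ {v w} x d (ys : List ℕ) →
                (∀ {y} → y ∈ filter (λ y → ¬? (y ≟ x)) ys → v y ≡ w y) →
                ∀ {y} → y ∈ ys → update A v x d y ≡ update A w x d y
  update-cong x d ys v≗w {y} y∈ys with y ≟ x
  ... | yes _  = refl
  ... | no y≢x = v≗w (∈-filter⁺ _ y∈ys y≢x)

  sat-coincidence : ∀ {v w} φ → (∀ {x} → x ∈ fv φ → v x ≡ w x) → sat A v φ → sat A w φ
  sat-coincidence (eq t u)   v≗w s =
    trans (sym (evalT-cong t (v≗w ∘ ∈-++⁺ˡ))) (trans s (evalT-cong u (v≗w ∘ ∈-++⁺ʳ (varsT t))))
  sat-coincidence (rel p ts) v≗w s = subst (predI A p) (evalTs-cong ts v≗w) s
  sat-coincidence (¬' φ)     v≗w s = s ∘ sat-coincidence φ (sym ∘ v≗w)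
  sat-coincidence (φ ∧' ψ)   v≗w (s , t) =
    sat-coincidence φ (v≗w ∘ ∈-++⁺ˡ) s , sat-coincidence ψ (v≗w ∘ ∈-++⁺ʳ (fv φ)) t
  sat-coincidence (φ ∨' ψ)   v≗w (inj₁ s) = inj₁ (sat-coincidence φ (v≗w ∘ ∈-++⁺ˡ) s)
  sat-coincidence (φ ∨' ψ)   v≗w (inj₂ t) = inj₂ (sat-coincidence ψ (v≗w ∘ ∈-++⁺ʳ (fv φ)) t)
  sat-coincidence (φ ⇒' ψ)   v≗w s =
    sat-coincidence ψ (v≗w ∘ ∈-++⁺ʳ (fv φ)) ∘ s ∘ sat-coincidence φ (sym ∘ v≗w ∘ ∈-++⁺ˡ)
  sat-coincidence (all' x φ) v≗w s d     = sat-coincidence φ (update-cong x d (fv φ) v≗w) (s d)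
  sat-coincidence (ex' x φ)  v≗w (d , s) = d , sat-coincidence φ (update-cong x d (fv φ) v≗w) s

  sentence-sat : ∀ {v w} φ → Sentence φ → sat A v φ → sat A w φ
  sentence-sat φ closed = sat-coincidence φ λ x∈fv → ⊥-elim (∉[] (subst (_ ∈_) closed x∈fv))

SameArrangement : {D D′ : Set} → (ℕ → Set) → (ℕ → D) → (ℕ → D′) → Set
SameArrangement V v w = ∀ x y → V x → V y → v x ≡ v y ⇔ w x ≡ w y

sameArrangement-sym : ∀ {D D′ V} {u : ℕ → D} {v : ℕ → D′} → SameArrangement V u v → SameArrangement V v u
sameArrangement-sym u≈v x y p q = ⇔.sym (u≈v x y p q)

sameArrangement-trans : ∀ {D D′ D″ V} {u : ℕ → D} {v : ℕ → D′} {w : ℕ → D″} →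
                        SameArrangement V u v → SameArrangement V v w → SameArrangement V u w
sameArrangement-trans u≈v v≈w x y p q = ⇔.trans (u≈v x y p q) (v≈w x y p q)

sameArrangement-restrict : ∀ {D D′ V W} {u : ℕ → D} {v : ℕ → D′} →
                           (∀ {x} → V x → W x) → SameArrangement W u v → SameArrangement V u v
sameArrangement-restrict V⊆W u≈v x y p q = u≈v x y (V⊆W p) (V⊆W q)

sat-induced-arrangement : ∀ {S} (A : Structure S) (v : ℕ → Dom A) (V : ℕ → Set) →
                          SatSet A v (arrangement V (_≡_ on (v ∘ proj₁)))
sat-induced-arrangement A v V _ (_ , _ , inj₁ (v≡ , refl)) = v≡
sat-induced-arrangement A v V _ (_ , _ , inj₂ (v≢ , refl)) = v≢

satSet-arrangement⇒sameArrangement :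
  ExcludedMiddle 0ℓ → ∀ {S S′} {V : ℕ → Set} {E : Rel (Σ ℕ V) 0ℓ}
  (A : Structure S) (B : Structure S′) {v : ℕ → Dom A} {w : ℕ → Dom B} →
  SatSet A v (arrangement V E) → SatSet B w (arrangement V E) → SameArrangement V v w
satSet-arrangement⇒sameArrangement em {E = E} A B A⊨α B⊨α x y p q with em {E (x , p) (y , q)}
... | yes xEy = mk⇔ (λ _ → B⊨α _ (_ , _ , inj₁ (xEy , refl))) (λ _ → A⊨α _ (_ , _ , inj₁ (xEy , refl)))
... | no ¬xEy = mk⇔ (⊥-elim ∘ A⊨α _ (_ , _ , inj₂ (¬xEy , refl))) (⊥-elim ∘ B⊨α _ (_ , _ , inj₂ (¬xEy , refl)))

module _ {D : Set} (v : ℕ → D) where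

  RowHolds : ∀ {k} → Vec ℕ k → Vec ℕ k → Set
  RowHolds = Pointwise (λ x y → v x ≡ v y)

  MemHolds : MemConstraint → Set
  MemHolds (memb xs ys) = Vec.Any (RowHolds xs) ys

module _ {S : Signature} (A : Structure S) (v : ℕ → Dom A) where

  sat-row : ∀ {k} (xs row : Vec ℕ (suc k)) →
            sat A v (foldr₁ _∧'_ (zipWith (λ x y → eq (var x) (var y)) xs row)) ⇔ RowHolds v xs row
  sat-row (x v∷ v[]) (y v∷ v[]) = mk⇔ (_p∷ p[]) λ { (vx≡vy p∷ p[]) → vx≡vy }
  sat-row (x v∷ xs@(_ v∷ _)) (y v∷ row@(_ v∷ _)) =
    mk⇔ (λ (vx≡vy , rest) → vx≡vy p∷ to (sat-row xs row) rest)
        (λ { (vx≡vy p∷ rest) → vx≡vy , from (sat-row xs row) rest })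

  sat-memFormula : ∀ c → sat A v (memFormula c) ⇔ MemHolds v c
  sat-memFormula (memb xs ys) = sat-rows ys
    where
    sat-rows : ∀ {l} (ys : Vec (Vec ℕ _) (suc l)) →
               sat A v (foldr₁ _∨'_ (vmap (λ row → foldr₁ _∧'_ (zipWith (λ x y → eq (var x) (var y)) xs row)) ys))
               ⇔ Vec.Any (RowHolds v xs) ys
    sat-rows (row v∷ v[]) =
      mk⇔ (Vec.here ∘ to (sat-row xs row))
          λ { (Vec.here r) → from (sat-row xs row) r ; (Vec.there ()) }
    sat-rows (row v∷ rows@(_ v∷ _)) =
      mk⇔ [ Vec.here ∘ to (sat-row xs row) , Vec.there ∘ to (sat-rows rows) ]′
          λ { (Vec.here r) → inj₁ (from (sat-row xs row) r) ; (Vec.there rs) → inj₂ (from (sat-rows rows) rs) }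

memHolds-transfer : ∀ {D D′} {v : ℕ → D} {w : ℕ → D′} c →
                    SameArrangement (_∈ memVars c) v w → MemHolds v c → MemHolds w c
memHolds-transfer {v = v} {w} c@(memb xs ys) v≈w =
  rows-transfer ys λ row∈ys → row-transfer ∈-++⁺ˡ (row⊆vars row∈ys)
  where
  row⊆vars : ∀ {row} → row ∈ toList ys → ∀ {y} → y ∈ toList row → y ∈ memVars c
  row⊆vars row∈ys y∈row = ∈-++⁺ʳ (toList xs) (∈-concat⁺′ y∈row (∈-map⁺ toList row∈ys))

  row-transfer : ∀ {k} {xs′ row : Vec ℕ k} → (∀ {x} → x ∈ toList xs′ → x ∈ memVars c) →
                 (∀ {y} → y ∈ toList row → y ∈ memVars c) → RowHolds v xs′ row → RowHolds w xs′ row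
  row-transfer xs′⊆ row⊆ p[] = p[]
  row-transfer xs′⊆ row⊆ (vx≡vy p∷ rest) =
    to (v≈w _ _ (xs′⊆ (here refl)) (row⊆ (here refl))) vx≡vy p∷ row-transfer (xs′⊆ ∘ there) (row⊆ ∘ there) rest

  rows-transfer : ∀ {l} (rows : Vec (Vec ℕ _) l) →
                  (∀ {row} → row ∈ toList rows → RowHolds v xs row → RowHolds w xs row) →
                  Vec.Any (RowHolds v xs) rows → Vec.Any (RowHolds w xs) rows
  rows-transfer (row v∷ rows) t (Vec.here r)   = Vec.here (t (here refl) r)
  rows-transfer (row v∷ rows) t (Vec.there rs) = Vec.there (rows-transfer rows (t ∘ there) rs)

module _ {S S′ : Signature} (A : Structure S) (B : Structure S′) {v : ℕ → Dom A} {w : ℕ → Dom B} where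

  sat-memLit-transfer : ∀ m → SameArrangement (_∈ memLitVars m) v w →
                        sat A v (memLitFormula m) → sat B w (memLitFormula m)
  sat-memLit-transfer (posM c) v≈w A⊨c =
    from (sat-memFormula B w c) (memHolds-transfer c v≈w (to (sat-memFormula A v c) A⊨c))
  sat-memLit-transfer (negM c) v≈w A⊭c B⊨c =
    A⊭c (from (sat-memFormula A v c)
      (memHolds-transfer c (sameArrangement-sym v≈w) (to (sat-memFormula B w c) B⊨c)))

  satSet-MemSet-transfer : ∀ M → SameArrangement (_∈ concatMap memLitVars M) v w →
                           SatSet A v (MemSet M) → SatSet B w (MemSet M)
  satSet-MemSet-transfer M v≈w A⊨M _ φ∈M with find φ∈M
  ... | m , m∈M , refl = sat-memLit-transfer m
    (sameArrangement-restrict (λ x∈m → ∈-concatMap⁺ memLitVars (lose m∈M x∈m)) v≈w)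
    (A⊨M _ (lose m∈M refl))

module _ {S : Signature} where

  -- The signature need not have a truth constant, so the empty conjunction is x₀ = x₀.
  ⋀ : List (Formula S) → Formula S
  ⋀ []       = eq (var 0) (var 0)
  ⋀ (φ ∷ φs) = φ ∧' ⋀ φs

  qf-⋀ : ∀ {φs} → All QF φs → QF (⋀ φs)
  qf-⋀ All.[]         = qf-eq
  qf-⋀ (qfφ All.∷ qfs) = qf-∧ qfφ (qf-⋀ qfs)

  sat-⋀ : ∀ (A : Structure S) v φs → sat A v (⋀ φs) ⇔ All (sat A v) φs
  sat-⋀ A v []       = mk⇔ (λ _ → All.[]) (λ _ → refl)
  sat-⋀ A v (φ ∷ φs) = mk⇔ (λ (s , ss) → s All.∷ to (sat-⋀ A v φs) ss)
                           (λ { (s All.∷ ss) → s , from (sat-⋀ A v φs) ss })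

  equationLiteral : {P : Set} → Dec P → ℕ → ℕ → Formula S
  equationLiteral (yes _) x y = eq (var x) (var y)
  equationLiteral (no _)  x y = ¬' eq (var x) (var y)

  qf-equationLiteral : ∀ {P : Set} (d : Dec P) x y → QF (equationLiteral d x y)
  qf-equationLiteral (yes _) x y = qf-eq
  qf-equationLiteral (no _)  x y = qf-¬ qf-eq

  sat-equationLiteral : ∀ (A : Structure S) v x y (d : Dec (v x ≡ v y)) → sat A v (equationLiteral d x y)
  sat-equationLiteral A v x y (yes vx≡vy) = vx≡vy
  sat-equationLiteral A v x y (no vx≢vy)  = vx≢vy

  sat-equationLiteral⇒⇔ : ∀ (A : Structure S) {w : ℕ → Dom A} {D : Set} {v : ℕ → D} x y (d : Dec (v x ≡ v y)) →
                          sat A w (equationLiteral d x y) → v x ≡ v y ⇔ w x ≡ w y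
  sat-equationLiteral⇒⇔ A x y (yes vx≡vy) wx≡wy = mk⇔ (λ _ → wx≡wy) (λ _ → vx≡vy)
  sat-equationLiteral⇒⇔ A x y (no vx≢vy)  wx≢wy = mk⇔ (⊥-elim ∘ vx≢vy) (⊥-elim ∘ wx≢wy)

  module _ {D : Set} (v : ℕ → D) (_≟v_ : ∀ x y → Dec (v x ≡ v y)) where

    literal : ℕ → ℕ → Formula S
    literal x y = equationLiteral (x ≟v y) x y

    diagram : List ℕ → List (Formula S)
    diagram L = concatMap (λ x → map (literal x) L) L

    all-diagram : ∀ {P : Formula S → Set} → (∀ x y → P (literal x y)) → ∀ L → All P (diagram L)
    all-diagram Pxy L = concat⁺ (map⁺ {xs = L} {f = λ x → map (literal x) L}
      (All.tabulate λ {x} _ → map⁺ (All.tabulate λ {y} _ → Pxy x y)))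

    ∈-diagram : ∀ {x y L} → x ∈ L → y ∈ L → literal x y ∈ diagram L
    ∈-diagram {x} {L = L} x∈L y∈L = ∈-concatMap⁺ (λ x′ → map (literal x′) L) (lose x∈L (∈-map⁺ (literal x) y∈L))

    qf-diagram : ∀ L → All QF (diagram L)
    qf-diagram = all-diagram λ x y → qf-equationLiteral (x ≟v y) x y

    diagram⇒sameArrangement : ∀ (A : Structure S) {w : ℕ → Dom A} L → All (sat A w) (diagram L) →
                              SameArrangement (_∈ L) v w
    diagram⇒sameArrangement A L A⊨diagram x y x∈L y∈L =
      sat-equationLiteral⇒⇔ A x y (x ≟v y) (All.lookup A⊨diagram (∈-diagram x∈L y∈L))

  sat-diagram : ∀ (A : Structure S) (v : ℕ → Dom A) (_≟v_ : ∀ x y → Dec (v x ≡ v y)) L →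
                All (sat A v) (diagram v _≟v_ L)
  sat-diagram A v _≟v_ = all-diagram v _≟v_ λ x y → sat-equationLiteral A v x y (x ≟v y)

qf-literal : ∀ {S} (l : Literal S) → QF (litFormula l)
qf-literal (posL _ atom-eq)  = qf-eq
qf-literal (posL _ atom-rel) = qf-rel
qf-literal (negL _ atom-eq)  = qf-¬ qf-eq
qf-literal (negL _ atom-rel) = qf-¬ qf-rel

module _ (em : ExcludedMiddle 0ℓ) {S : Signature} {T : Theory S} (T-stably-infinite : StablyInfinite T) where

  infiniteModel-sameArrangement :
    (Γ : List (Literal S)) (L : List ℕ) (A : Structure S) (v : ℕ → Dom A) →
    SatSet A v T → All (sat A v ∘ litFormula) Γ →
    Σ (Structure S) λ A′ → Σ (ℕ → Dom A′) λ v′ →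
      Infinite (Dom A′) × SatSet A′ v′ T × All (sat A′ v′ ∘ litFormula) Γ × SameArrangement (_∈ L) v v′
  infiniteModel-sameArrangement Γ L A v A⊨T A⊨Γ =
    let A′ , v′ , A′-infinite , A′⊨T , A′⊨F = T-stably-infinite F qf-F (A , v , A⊨T , λ { _ refl → A⊨F })
        A′⊨Γ , A′⊨diagram = ++⁻ (map litFormula Γ) (to (sat-⋀ A′ v′ _) A′⊨F)
    in A′ , v′ , A′-infinite , A′⊨T , map⁻ A′⊨Γ , diagram⇒sameArrangement v _≟v_ A′ L A′⊨diagram
    where
    _≟v_ : ∀ x y → Dec (v x ≡ v y)
    x ≟v y = em

    F : Formula S
    F = ⋀ (map litFormula Γ ++ diagram v _≟v_ L)

    qf-F : QF F
    qf-F = qf-⋀ (++⁺ (map⁺ (All.tabulate λ {l} _ → qf-literal l)) (qf-diagram v _≟v_ L))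

    A⊨F : sat A v F
    A⊨F = from (sat-⋀ A v _) (++⁺ (map⁺ A⊨Γ) (sat-diagram A v _≟v_ L))

index-∈-lookup : ∀ {A : Set} (xs : List A) i → index (∈-lookup {xs = xs} i) ≡ i
index-∈-lookup (x ∷ xs) fzero    = refl
index-∈-lookup (x ∷ xs) (fsuc i) = cong fsuc (index-∈-lookup xs i)

-- Membership in a duplicate-free list is proof-irrelevant, so indexing is inverse to lookup.
covering⇒↔Fin : ∀ {A : Set} (_≟_ : DecidableEquality A) (X : List A) → (∀ a → a ∈ X) →
                A ↔ Fin (length (deduplicate _≟_ X))
covering⇒↔Fin _≟_ X X-covers = mk↔ₛ′ (index ∘ ∈U) (lookup U) index∘lookup (sym ∘ lookup-index ∘ ∈U)
  where
  U = deduplicate _≟_ X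

  ∈U : ∀ a → a ∈ U
  ∈U a = ∈-deduplicate⁺ _≟_ (X-covers a)

  index∘lookup : ∀ i → index (∈U (lookup U i)) ≡ i
  index∘lookup i = trans (cong index (unique⇒irrelevant (deduplicate-! _≟_ X) _ _)) (index-∈-lookup U i)

module _ (em : ExcludedMiddle 0ℓ) {D : Set} (D-infinite : Infinite D) where

  ∃∉ : (X : List D) → ∃ λ d → d ∉ X
  ∃∉ X with em {∃ λ d → d ∉ X}
  ... | yes d∉X = d∉X
  ... | no  ∄d∉X = ⊥-elim (D-infinite _ (covering⇒↔Fin (λ _ _ → em) X X-covers))
    where
    X-covers : ∀ d → d ∈ X
    X-covers d = decidable-stable em λ d∉X → ∄d∉X (d , d∉X)

  module FreshSequence (X : List D) where

    mutual
      fresh : ℕ → D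
      fresh n = proj₁ (∃∉ (X ++ earlier n))

      earlier : ℕ → List D
      earlier zero    = []
      earlier (suc n) = fresh n ∷ earlier n

    fresh∉ : ∀ n → fresh n ∉ X
    fresh∉ n = proj₂ (∃∉ (X ++ earlier n)) ∘ ∈-++⁺ˡ

    fresh∈earlier : ∀ {m n} → m < n → fresh m ∈ earlier n
    fresh∈earlier {n = suc n} (s≤s m≤n) with m≤n⇒m<n∨m≡n m≤n
    ... | inj₁ m<n  = there (fresh∈earlier m<n)
    ... | inj₂ refl = here refl

    fresh-<-≢ : ∀ {m n} → m < n → fresh m ≢ fresh n
    fresh-<-≢ {n = n} m<n fm≡fn =
      proj₂ (∃∉ (X ++ earlier n)) (∈-++⁺ʳ X (subst (_∈ earlier n) fm≡fn (fresh∈earlier m<n)))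

    fresh-injective : Injective _≡_ _≡_ fresh
    fresh-injective {m} {n} fm≡fn with <-cmp m n
    ... | tri< m<n _ _ = ⊥-elim (fresh-<-≢ m<n fm≡fn)
    ... | tri≈ _ m≡n _ = m≡n
    ... | tri> _ _ n<m = ⊥-elim (fresh-<-≢ n<m (sym fm≡fn))

module Amalgamation (em : ExcludedMiddle 0ℓ) {D K : Set} (D-infinite : Infinite D)
  (v : ℕ → D) (u : ℕ → K) (L N : List ℕ) (v≈u : SameArrangement (λ x → x ∈ L × x ∈ N) v u) where

  open FreshSequence em D-infinite (map v L)

  SharedValue : K → Set
  SharedValue k = ∃ λ z → (z ∈ L × z ∈ N) × u z ≡ k

  ValueOnN : K → Set
  ValueOnN k = ∃ λ z → z ∈ N × u z ≡ k

  -- The junk value 0 is harmless: code is only used at values of variables of N.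
  code : ∀ {k} → Dec (ValueOnN k) → ℕ
  code (yes (z , _)) = z
  code (no _)        = 0

  code-correct : ∀ {x} → x ∈ N → (d : Dec (ValueOnN (u x))) → u (code d) ≡ u x
  code-correct x∈N (yes (_ , _ , uz≡ux)) = uz≡ux
  code-correct x∈N (no ∄z)               = ⊥-elim (∄z (_ , x∈N , refl))

  valueFor : ∀ {k} → Dec (SharedValue k) → D
  valueFor     (yes (z , _)) = v z
  valueFor {k} (no _)        = fresh (code (em {ValueOnN k}))

  translate : K → D
  translate k = valueFor (em {SharedValue k})

  valueFor-shared : ∀ {x} → x ∈ L → x ∈ N → (d : Dec (SharedValue (u x))) → valueFor d ≡ v x
  valueFor-shared x∈L x∈N (yes (z , z∈L∩N , uz≡ux)) = from (v≈u z _ z∈L∩N (x∈L , x∈N)) uz≡ux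
  valueFor-shared x∈L x∈N (no ∄z)                   = ⊥-elim (∄z (_ , (x∈L , x∈N) , refl))

  valueFor-injective : ∀ {x y} → x ∈ N → y ∈ N → (d : Dec (SharedValue (u x))) (e : Dec (SharedValue (u y))) →
                       valueFor d ≡ valueFor e → u x ≡ u y
  valueFor-injective _ _ (yes (z , z∈L∩N , uz≡ux)) (yes (z′ , z′∈L∩N , uz′≡uy)) vz≡vz′ =
    trans (sym uz≡ux) (trans (to (v≈u z z′ z∈L∩N z′∈L∩N) vz≡vz′) uz′≡uy)
  valueFor-injective _ _ (yes (z , (z∈L , _) , _)) (no _) vz≡fresh =
    ⊥-elim (fresh∉ _ (subst (_∈ map v L) vz≡fresh (∈-map⁺ v z∈L)))
  valueFor-injective _ _ (no _) (yes (z , (z∈L , _) , _)) fresh≡vz =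
    ⊥-elim (fresh∉ _ (subst (_∈ map v L) (sym fresh≡vz) (∈-map⁺ v z∈L)))
  valueFor-injective x∈N y∈N (no _) (no _) fresh≡fresh =
    trans (sym (code-correct x∈N em)) (trans (cong u (fresh-injective fresh≡fresh)) (code-correct y∈N em))

  extendAt : ∀ {x} → Dec (x ∈ L) → D
  extendAt {x} (yes _) = v x
  extendAt {x} (no _)  = translate (u x)

  w : ℕ → D
  w x = extendAt (em {x ∈ L})

  w-on-L : ∀ {x} → x ∈ L → w x ≡ v x
  w-on-L {x} x∈L with em {x ∈ L}
  ... | yes _   = refl
  ... | no x∉L  = ⊥-elim (x∉L x∈L)

  -- On a shared variable both clauses of extendAt agree.
  w-on-N : ∀ {x} → x ∈ N → w x ≡ translate (u x)
  w-on-N {x} x∈N with em {x ∈ L}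
  ... | yes x∈L = sym (valueFor-shared x∈L x∈N em)
  ... | no _    = refl

  w≈u : SameArrangement (_∈ N) w u
  w≈u x y x∈N y∈N = mk⇔
    (λ wx≡wy → valueFor-injective x∈N y∈N em em (trans (sym (w-on-N x∈N)) (trans wx≡wy (w-on-N y∈N))))
    (λ ux≡uy → trans (w-on-N x∈N) (trans (cong translate ux≡uy) (sym (w-on-N y∈N))))

amalgamate : ExcludedMiddle 0ℓ → ∀ {D K : Set} → Infinite D → (v : ℕ → D) (u : ℕ → K) (L N : List ℕ) →
             SameArrangement (λ x → x ∈ L × x ∈ N) v u →
             Σ (ℕ → D) λ w → (∀ {x} → x ∈ L → w x ≡ v x) × SameArrangement (_∈ N) w u
amalgamate em D-infinite v u L N v≈u = w , w-on-L , w≈u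
  where open Amalgamation em D-infinite v u L N v≈u

litSet-coincidence : ∀ {S} (A : Structure S) {v w : ℕ → Dom A} Γ →
                     (∀ {x} → x ∈ concatMap litVars Γ → v x ≡ w x) →
                     All (sat A v ∘ litFormula) Γ → SatSet A w (LitSet Γ)
litSet-coincidence A Γ v≗w A⊨Γ _ φ∈Γ with find φ∈Γ
... | l , l∈Γ , refl =
  sat-coincidence A (litFormula l) (v≗w ∘ ∈-concatMap⁺ litVars ∘ lose l∈Γ) (All.lookup A⊨Γ l∈Γ)

emptyReduct : ∀ {S} → Structure S → Structure emptySig
emptyReduct A = record { Dom = Dom A ; funI = λ () ; predI = λ () }

ConsistentArrangement : ∀ {S} → Theory S → List (Literal S) → List MemLit → Set₁
ConsistentArrangement T Γ M =
  Σ (Rel (Σ ℕ (Shared Γ M)) 0ℓ) λ E →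
    IsEquivalence E
    × TSatisfiable T (LitSet Γ ∪ arrangement (Shared Γ M) E)
    × Satisfiable {emptySig} (MemSet M ∪ arrangement (Shared Γ M) E)

separate : ∀ {S} {T : Theory S} Γ M → TSatisfiable T (LitSet Γ ∪ MemSet M) → ConsistentArrangement T Γ M
separate Γ M (A , v , A⊨T , A⊨Γ∪M) =
  (_≡_ on (v ∘ proj₁)) , On.isEquivalence (v ∘ proj₁) isEquivalence ,
  (A , v , A⊨T , λ φ → [ A⊨Γ∪M φ ∘ inj₁ , sat-induced-arrangement A v _ φ ]′) ,
  (emptyReduct A , v , λ φ → [ satSet-MemSet-transfer A (emptyReduct A) M (λ _ _ _ _ → ⇔.refl) (λ ψ → A⊨Γ∪M ψ ∘ inj₂) φ
                             , sat-induced-arrangement (emptyReduct A) v _ φ ]′)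

combine : ExcludedMiddle 0ℓ → ∀ {S} {T : Theory S} → IsTheory T → StablyInfinite T →
          ∀ Γ M → ConsistentArrangement T Γ M → TSatisfiable T (LitSet Γ ∪ MemSet M)
combine em T-theory T-stably-infinite Γ M (_ , _ , (A , vA , A⊨T , A⊨Γ∪α) , (B , vB , B⊨M∪α)) =
  let A′ , v′ , A′-infinite , A′⊨T , A′⊨Γ , vA≈v′ =
        infiniteModel-sameArrangement em T-stably-infinite Γ Lg A vA A⊨T A⊨Γ
      v′≈vB = sameArrangement-trans (sameArrangement-sym (sameArrangement-restrict proj₁ vA≈v′)) vA≈vB
      w , w≗v′ , w≈vB = amalgamate em A′-infinite v′ vB Lg Lm v′≈vB
  in A′ , w , (λ φ φ∈T → sentence-sat A′ φ (T-theory φ φ∈T) (A′⊨T φ φ∈T))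
     , λ φ → [ litSet-coincidence A′ Γ (sym ∘ w≗v′) A′⊨Γ φ
             , satSet-MemSet-transfer B A′ M (sameArrangement-sym w≈vB) (λ ψ → B⊨M∪α ψ ∘ inj₁) φ ]′
  where
  Lg = concatMap litVars Γ
  Lm = concatMap memLitVars M

  A⊨Γ : All (sat A vA ∘ litFormula) Γ
  A⊨Γ = All.tabulate λ l∈Γ → A⊨Γ∪α _ (inj₁ (lose l∈Γ refl))

  vA≈vB : SameArrangement (Shared Γ M) vA vB
  vA≈vB = satSet-arrangement⇒sameArrangement em A B (λ φ → A⊨Γ∪α φ ∘ inj₂) (λ φ → B⊨M∪α φ ∘ inj₂)

lemma2 : ExcludedMiddle 0ℓ → ExcludedMiddle (lsuc 0ℓ) →
    (S : Signature) (T : Theory S) → IsTheory T → StablyInfinite T →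
    (Γ : List (Literal S)) (M : List MemLit) →
    TSatisfiable T (LitSet Γ ∪ MemSet M)
    ⇔ Σ (Rel (Σ ℕ (Shared Γ M)) 0ℓ) (λ E →
        IsEquivalence E
        × TSatisfiable T (LitSet Γ ∪ arrangement (Shared Γ M) E)
        × Satisfiable {emptySig} (MemSet M ∪ arrangement (Shared Γ M) E))
-- Only propositions in Set need to be decided.
lemma2 em _ S T T-theory T-stably-infinite Γ M =
  mk⇔ (separate Γ M) (combine em T-theory T-stably-infinite Γ M)
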